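{- Let $s$ be any clique size. In the dynamic network model described in the context, restricted to topology changes that are node insertions (together with the new node's incident edges), node deletions, or edge deletions, the deterministic $1$-round bandwidth complexity of $\mathsf{List}(K_s)$ is $O(1)$. That is, there is a deterministic algorithm in which, in every round, each node sends each neighbor a message of $O(1)$ bits, and after the single round of communication following each topology change every $s$-clique of the current graph is listed by at least one of its nodes and no node lists a set of $s$ nodes that is not an $s$-clique of the current graph.
   Context: Dynamic network model: the network is a sequence of graphs $(G_0, G_1, \dots, G_r)$. All nodes of the initial graph $G_0$ know its complete topology. Each $G_i$ is either identical to $G_{i-1}$ or differs from it by a single topology change of an allowed type: edge insertion, edge deletion, node insertion (together with all its incident edges), or node deletion (together with all its incident edges). Each node has a unique ID of $O(\log n)$ bits, where $n$ is the current number of nodes, and knows the IDs of its current neighbors. Communication is synchronous. Each round consists of: (1) the topology change occurs, and each node learns its new neighbor list (a node can compare it with its previous neighbor list, but cannot distinguish the insertion of edge $\{u,v\}$ from the insertion of node $v$); (2) each node sends to each of its current neighbors a message of at most $B$ bits (messages to different neighbors may differ), where $B$ is the bandwidth; (3) nodes receive messages and output their lists. A deleted node sends nothing and lists nothing. $K_s$ denotes the clique on $s$ vertices. For a graph $H$, the problem $\mathsf{List}(H)$ requires that in each round, every subgraph of the current graph $G_i$ isomorphic to $H$ be listed (i.e., the IDs of all its nodes output) by at least one of its nodes, and that every listed set be a subgraph of $G_i$ isomorphic to $H$. The deterministic $1$-round bandwidth complexity of a problem is the minimum bandwidth $B$ for which there is a deterministic algorithm whose output at every node is correct after one round of communication following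 each topology change. -}

module Defs where

open import Data.Nat using (ℕ; suc; _<_; _≡ᵇ_; _⊔_; _^_)
open import Data.Bool using (Bool; true; false; _∧_; _∨_; not; if_then_else_)
open import Data.List using (List; []; _∷_; map; filterᵇ; upTo; length)
open import Data.Bool.ListAction using (any)
open import Data.List.Membership.Propositional using (_∈_)
open import Data.List.Relation.Unary.All using (All)
open import Data.List.Relation.Unary.AllPairs using (AllPairs)
open import Data.List.Relation.Unary.Unique.Propositional using (Unique)
open import Data.List.Relation.Binary.Permutation.Propositional using (_↭_)
open import Data.Maybe using (Maybe; just; nothing; fromMaybe)
open import Data.Product using (Σ; ∃; ∃-syntax; _×_; _,_)
open import Data.Unit using (⊤)
open import Data.Vec.Bounded using (Vec≤)
open import Relation.Binary.PropositionalEquality using (_≡_)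

-- Nodes are identified with their IDs (natural numbers).
-- V v = true  : node with ID v is present.
-- E u v = true : edge {u,v} is present.
-- bnd : an upper bound on the IDs of present nodes (makes the node set finite
--       and lets neighbour lists be computed; it carries no other meaning).

record Graph : Set where
  field
    bnd : ℕ
    V   : ℕ → Bool
    E   : ℕ → ℕ → Bool
open Graph public

record WF (G : Graph) : Set where
  field
    bounded    : ∀ v → V G v ≡ true → v < bnd G
    symmetric  : ∀ u v → E G u v ≡ E G v u
    irreflexive : ∀ v → E G v v ≡ false
    endpoints  : ∀ u v → E G u v ≡ true → V G u ≡ true

nodes : Graph → List ℕ
nodes G = filterᵇ (V G) (upTo (bnd G))

nbrs : Graph → ℕ → List ℕ
nbrs G v = filterᵇ (λ u → V G u ∧ E G v u) (upTo (bnd G))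

data Change : Set where
  noChange : Change
  insNode  : ℕ → List ℕ → Change
  delNode  : ℕ → Change
  delEdge  : ℕ → ℕ → Change

memb : ℕ → List ℕ → Bool
memb x xs = any (λ y → x ≡ᵇ y) xs

ValidChange : Graph → Change → Set
ValidChange G noChange      = ⊤
ValidChange G (insNode v N) = V G v ≡ false × All (λ u → V G u ≡ true) N
ValidChange G (delNode v)   = V G v ≡ true
ValidChange G (delEdge u v) = E G u v ≡ true

apply : Graph → Change → Graph
apply G noChange = G
apply G (insNode v N) = record
  { bnd = bnd G ⊔ suc v
  ; V   = λ w → (w ≡ᵇ v) ∨ V G w
  ; E   = λ a b → E G a b ∨ ((a ≡ᵇ v) ∧ memb b N) ∨ ((b ≡ᵇ v) ∧ memb a N)
  }
apply G (delNode v) = record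
  { bnd = bnd G
  ; V   = λ w → not (w ≡ᵇ v) ∧ V G w
  ; E   = λ a b → not (a ≡ᵇ v) ∧ not (b ≡ᵇ v) ∧ E G a b
  }
apply G (delEdge u v) = record
  { bnd = bnd G
  ; V   = V G
  ; E   = λ a b → E G a b ∧ not (((a ≡ᵇ u) ∧ (b ≡ᵇ v)) ∨ ((a ≡ᵇ v) ∧ (b ≡ᵇ u)))
  }

-- IDs have O(log n) bits: every present ID is < (n+1)^c, n = current #nodes.
IDsOK : ℕ → Graph → Set
IDsOK c G = ∀ v → V G v ≡ true → v < suc (length (nodes G)) ^ c

Msg : ℕ → Set
Msg B = Vec≤ Bool B

record Alg (B : ℕ) : Set₁ where
  field
    State   : Set
    -- initial state of a node of G₀: knows its ID and the whole of G₀
    init    : ℕ → Graph → State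
    -- initial state of a node inserted later: knows only its ID
    initNew : ℕ → State
    -- message sent, given the current state, the current neighbour list,
    -- and the ID of the neighbour the message is addressed to
    msg     : State → List ℕ → ℕ → Msg B
    -- new state, given old state, current neighbour list and the received
    -- messages (sender ID, message), one for each current neighbour
    update  : State → List ℕ → List (ℕ × Msg B) → State
    output  : State → List (List ℕ)
open Alg public

-- Global configuration: state of each present node (nothing = not present).
Config : ∀ {B} → Alg B → Set
Config A = ℕ → Maybe (State A)

initConfig : ∀ {B} (A : Alg B) → Graph → Config A
initConfig A G w = if V G w then just (init A w G) else nothing

-- One synchronous round on the (already changed) graph G'.
round : ∀ {B} (A : Alg B) → Graph → Config A → Config A
round A G' σ w =
  if V G' w then just (update A (st w) (nbrs G' w) (incoming w)) else nothing
  where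
  st : ℕ → State A
  st u = fromMaybe (initNew A u) (σ u)
  incoming : ℕ → List (ℕ × Msg _)
  incoming w = map (λ u → u , msg A (st u) (nbrs G' u) w) (nbrs G' w)

IsClique : ℕ → Graph → List ℕ → Set
IsClique s G L =
  length L ≡ s × Unique L × All (λ u → V G u ≡ true) L
    × AllPairs (λ a b → E G a b ≡ true) L

Correct : ∀ {B} (A : Alg B) → ℕ → Graph → Config A → Set
Correct A s G σ =
  (∀ v st → σ v ≡ just st → ∀ L → L ∈ output A st → IsClique s G L)
  × (∀ K → IsClique s G K →
       ∃[ v ] (v ∈ K × ∃[ st ] (σ v ≡ just st × ∃[ L ] (L ∈ output A st × L ↭ K))))

Good : ∀ {B} (A : Alg B) → ℕ → ℕ → Graph → Config A → List Change → Set
Good A s c G σ [] = ⊤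
Good A s c G σ (ch ∷ chs) =
  ValidChange G ch → IDsOK c (apply G ch) →
    Correct A s (apply G ch) (round A (apply G ch) σ)
    × Good A s c (apply G ch) (round A (apply G ch) σ) chs

{-# OPTIONS --safe #-}
module Submission where

-- Ranks order the nodes by insertion time. Each node keeps its last neighbour list and a table
-- of known edges between its neighbours; the invariant is that the table is sound and contains
-- every edge pq among the node's neighbours unless p and q are both older than the node. Then
-- every s-clique is listed by its oldest member. Three bits per message (the sender gained a
-- neighbour, lost a neighbour, lost a neighbour adjacent to the receiver) maintain the invariant.
-- A newly inserted node is the youngest, so it owes nothing, and an old neighbour u of it learns
-- its adjacencies from the neighbours that report a gain. After a deletion, u drops pq when u lost
-- nothing, p and q both lost something, and one of them lost a neighbour adjacent to u: for a
-- deleted edge pq the older of p and q knows that the other one is adjacent to u, while for a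
-- deleted node such a report would mean that u lost that node too.

open import Defs
open import Data.Bool using (Bool; true; false; _∧_; _∨_; not; T?; if_then_else_)
open import Data.Bool.ListAction using (any; all)
open import Data.Bool.Properties using (T-≡; ∧-comm; ∨-comm; ∧-identityʳ)
open import Data.Empty using (⊥; ⊥-elim)
open import Data.List using (List; []; _∷_; map; filterᵇ; upTo; length; cartesianProductWith)
open import Data.List.Extrema.Nat using (argmin; argmin-sel; f[argmin]≤f[⊤]; f[argmin]≤f[xs])
open import Data.List.Membership.Propositional using (_∈_; lose; find)
open import Data.List.Membership.Propositional.Properties
  using (∈-upTo⁺; ∈-filter⁺; ∈-filter⁻; ∈-cartesianProductWith⁺; ∈-cartesianProductWith⁻)
open import Data.List.Relation.Binary.Permutation.Propositional using (_↭_; ↭-refl)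
open import Data.List.Relation.Unary.All as All using (All; []; _∷_)
open import Data.List.Relation.Unary.All.Properties using (all⁺; all⁻)
open import Data.List.Relation.Unary.AllPairs as AllPairs using (AllPairs; []; _∷_)
open import Data.List.Relation.Unary.Any using (here; there)
open import Data.List.Relation.Unary.Any.Properties using (any⁺; any⁻)
open import Data.List.Relation.Unary.Unique.Propositional using (Unique)
open import Data.Maybe using (Maybe; just; nothing; fromMaybe)
open import Data.Maybe.Properties using (just-injective)
open import Data.Nat using (ℕ; zero; suc; _≤_; _<_; _≡ᵇ_; _⊔_; _≟_; _<?_; z≤n; s≤s)
open import Data.Nat.Properties
  using (≡ᵇ⇒≡; ≡⇒≡ᵇ; <-trans; ≤-trans; <-asym; n<1+n; m≤m⊔n; m≤n⊔m; ≤⇒≯)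
open import Data.Product using (Σ; ∃-syntax; _×_; _,_; proj₁; proj₂; map₂)
open import Data.Sum using (_⊎_; inj₁; inj₂; [_,_])
open import Data.Unit using (tt)
open import Data.Vec using ([]; _∷_; toList)
open import Data.Vec.Bounded as Vec≤ using (Vec≤)
open import Function using (_∘_)
open import Function.Bundles using (Equivalence)
open import Relation.Binary.PropositionalEquality
  using (_≡_; _≢_; refl; sym; trans; cong; cong₂; subst; subst₂)
open import Relation.Nullary using (¬_; yes; no)

open Equivalence using (to; from)

∧-true⁻ : ∀ {a b} → a ∧ b ≡ true → a ≡ true × b ≡ true
∧-true⁻ {true} {true} _ = refl , refl

∧-true⁺ : ∀ {a b} → a ≡ true → b ≡ true → a ∧ b ≡ true
∧-true⁺ refl refl = refl

∨-true⁻ : ∀ {a b} → a ∨ b ≡ true → a ≡ true ⊎ b ≡ true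
∨-true⁻ {true} _ = inj₁ refl
∨-true⁻ {false} b≡true = inj₂ b≡true

∨-trueˡ : ∀ {a} b → a ≡ true → a ∨ b ≡ true
∨-trueˡ b refl = refl

∨-trueʳ : ∀ a {b} → b ≡ true → a ∨ b ≡ true
∨-trueʳ true _ = refl
∨-trueʳ false b≡true = b≡true

not-true⁻ : ∀ {a} → not a ≡ true → a ≡ false
not-true⁻ {false} _ = refl

not-true⁺ : ∀ {a} → a ≡ false → not a ≡ true
not-true⁺ refl = refl

≡true⊎≡false : ∀ a → a ≡ true ⊎ a ≡ false
≡true⊎≡false true = inj₁ refl
≡true⊎≡false false = inj₂ refl

≡true⇒≢false : ∀ {a} → a ≡ true → a ≢ false
≡true⇒≢false refl ()

≢true⇒≡false : ∀ {a} → ¬ a ≡ true → a ≡ false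
≢true⇒≡false {true} a≢true = ⊥-elim (a≢true refl)
≢true⇒≡false {false} _ = refl

≢false⇒≡true : ∀ {a} → ¬ a ≡ false → a ≡ true
≢false⇒≡true {true} _ = refl
≢false⇒≡true {false} a≢false = ⊥-elim (a≢false refl)

≡ᵇ-true⇒≡ : ∀ {m n} → (m ≡ᵇ n) ≡ true → m ≡ n
≡ᵇ-true⇒≡ {m} {n} e = ≡ᵇ⇒≡ m n (from T-≡ e)

≡ᵇ-refl : ∀ n → (n ≡ᵇ n) ≡ true
≡ᵇ-refl n = to T-≡ (≡⇒≡ᵇ n n refl)

≢⇒≡ᵇ-false : ∀ {m n} → m ≢ n → (m ≡ᵇ n) ≡ false
≢⇒≡ᵇ-false m≢n = ≢true⇒≡false (m≢n ∘ ≡ᵇ-true⇒≡)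

module _ {A : Set} where

  any-true⁺ : ∀ (p : A → Bool) {x xs} → x ∈ xs → p x ≡ true → any p xs ≡ true
  any-true⁺ p x∈xs px = to T-≡ (any⁺ p (lose x∈xs (from T-≡ px)))

  any-true⁻ : ∀ (p : A → Bool) xs → any p xs ≡ true → ∃[ x ] (x ∈ xs × p x ≡ true)
  any-true⁻ p xs e with x , x∈xs , px ← find (any⁻ p xs (from T-≡ e)) = x , x∈xs , to T-≡ px

  all-true⁺ : ∀ (p : A → Bool) {xs} → All (λ x → p x ≡ true) xs → all p xs ≡ true
  all-true⁺ p ps = to T-≡ (all⁻ p (All.map (from T-≡) ps))

  all-true⁻ : ∀ (p : A → Bool) xs → all p xs ≡ true → All (λ x → p x ≡ true) xs
  all-true⁻ p xs e = All.map (to T-≡) (all⁺ p xs (from T-≡ e))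

  ∈-filterᵇ⁺ : ∀ (p : A → Bool) {x xs} → x ∈ xs → p x ≡ true → x ∈ filterᵇ p xs
  ∈-filterᵇ⁺ p x∈xs px = ∈-filter⁺ (T? ∘ p) x∈xs (from T-≡ px)

  ∈-filterᵇ⁻ : ∀ (p : A → Bool) {x} xs → x ∈ filterᵇ p xs → x ∈ xs × p x ≡ true
  ∈-filterᵇ⁻ p xs m = map₂ (to T-≡) (∈-filter⁻ (T? ∘ p) {xs = xs} m)

  allPairsᵇ : (A → A → Bool) → List A → Bool
  allPairsᵇ f [] = true
  allPairsᵇ f (x ∷ xs) = all (f x) xs ∧ allPairsᵇ f xs

  allPairsᵇ-true⁺ : ∀ f {xs} → AllPairs (λ a b → f a b ≡ true) xs → allPairsᵇ f xs ≡ true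
  allPairsᵇ-true⁺ f [] = refl
  allPairsᵇ-true⁺ f (fx ∷ fxs) = ∧-true⁺ (all-true⁺ (f _) fx) (allPairsᵇ-true⁺ f fxs)

  allPairsᵇ-true⁻ : ∀ f xs → allPairsᵇ f xs ≡ true → AllPairs (λ a b → f a b ≡ true) xs
  allPairsᵇ-true⁻ f [] _ = []
  allPairsᵇ-true⁻ f (x ∷ xs) e with fx , fxs ← ∧-true⁻ {all (f x) xs} e =
    all-true⁻ (f x) xs fx ∷ allPairsᵇ-true⁻ f xs fxs

  AllPairs-∈ : ∀ {R : A → A → Set} → (∀ {x y} → R x y → R y x) →
               ∀ {xs x y} → AllPairs R xs → x ∈ xs → y ∈ xs → x ≢ y → R x y
  AllPairs-∈ sym-R (_ ∷ _) (here refl) (here refl) x≢y = ⊥-elim (x≢y refl)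
  AllPairs-∈ sym-R (rx ∷ _) (here refl) (there y∈xs) _ = All.lookup rx y∈xs
  AllPairs-∈ sym-R (rx ∷ _) (there x∈xs) (here refl) _ = sym-R (All.lookup rx x∈xs)
  AllPairs-∈ sym-R (_ ∷ rxs) (there x∈xs) (there y∈xs) x≢y = AllPairs-∈ sym-R rxs x∈xs y∈xs x≢y

  AllPairs-mapWithAll : ∀ {P : A → Set} {R S : A → A → Set} →
    (∀ {x y} → P x → P y → R x y → S x y) → ∀ {xs} → All P xs → AllPairs R xs → AllPairs S xs
  AllPairs-mapWithAll f [] [] = []
  AllPairs-mapWithAll f (px ∷ pxs) (rx ∷ rxs) =
    All.zipWith (λ (py , r) → f px py r) (pxs , rx) ∷ AllPairs-mapWithAll f pxs rxs

  tuples : ℕ → List A → List (List A)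
  tuples zero M = [] ∷ []
  tuples (suc k) M = cartesianProductWith _∷_ M (tuples k M)

  tuples-length : ∀ k M {L} → L ∈ tuples k M → length L ≡ k
  tuples-length zero M (here refl) = refl
  tuples-length (suc k) M L∈
    with _ , _ , _ , L′∈ , refl ← ∈-cartesianProductWith⁻ _∷_ M (tuples k M) L∈ =
    cong suc (tuples-length k M L′∈)

  ∈-tuples : ∀ M {L} → All (_∈ M) L → L ∈ tuples (length L) M
  ∈-tuples M [] = here refl
  ∈-tuples M (x∈M ∷ L⊆M) = ∈-cartesianProductWith⁺ _∷_ x∈M (∈-tuples M L⊆M)

  argmin-∈ : ∀ (f : A → ℕ) x xs → argmin f x xs ∈ x ∷ xs
  argmin-∈ f x xs with argmin-sel f x xs
  ... | inj₁ ≡x = here ≡x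
  ... | inj₂ ∈xs = there ∈xs

  argmin-minimal : ∀ (f : A → ℕ) x xs → All (λ y → f (argmin f x xs) ≤ f y) (x ∷ xs)
  argmin-minimal f x xs = f[argmin]≤f[⊤] {f = f} x xs ∷ f[argmin]≤f[xs] {f = f} x xs

memb⁺ : ∀ {x xs} → x ∈ xs → memb x xs ≡ true
memb⁺ {x} x∈xs = any-true⁺ (x ≡ᵇ_) x∈xs (≡ᵇ-refl x)

memb⁻ : ∀ {x xs} → memb x xs ≡ true → x ∈ xs
memb⁻ {x} {xs} e with y , y∈xs , x≡ᵇy ← any-true⁻ (x ≡ᵇ_) xs e
                  with refl ← ≡ᵇ-true⇒≡ {x} x≡ᵇy = y∈xs

module _ {G : Graph} (wf : WF G) where
  open WF wf

  endpointʳ : ∀ u v → E G u v ≡ true → V G v ≡ true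
  endpointʳ u v e = endpoints v u (trans (symmetric v u) e)

  E-sym : ∀ {u v} → E G u v ≡ true → E G v u ≡ true
  E-sym {u} {v} e = trans (symmetric v u) e

  E⇒≢ : ∀ {u v} → E G u v ≡ true → u ≢ v
  E⇒≢ {u} e refl = ≡true⇒≢false e (irreflexive u)

  memb-nbrs : ∀ v w → memb w (nbrs G v) ≡ E G v w
  memb-nbrs v w with E G v w in e
  ... | true = memb⁺ (∈-filterᵇ⁺ (λ u → V G u ∧ E G v u)
                 (∈-upTo⁺ (bounded w (endpointʳ v w e))) (∧-true⁺ (endpointʳ v w e) e))
  ... | false = ≢true⇒≡false λ m → ≡true⇒≢false
                 (proj₂ (∧-true⁻ (proj₂ (∈-filterᵇ⁻ _ (upTo (bnd G)) (memb⁻ m))))) e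

  ∈-nbrs⁻ : ∀ {v w} → w ∈ nbrs G v → E G v w ≡ true
  ∈-nbrs⁻ {v} {w} m = trans (sym (memb-nbrs v w)) (memb⁺ m)

  ∈-nbrs⁺ : ∀ {v w} → E G v w ≡ true → w ∈ nbrs G v
  ∈-nbrs⁺ {v} {w} e = memb⁻ (trans (memb-nbrs v w) e)

memb-absent : ∀ {G : Graph} {v N} → All (λ u → V G u ≡ true) N → V G v ≡ false → memb v N ≡ false
memb-absent N-present v-absent = ≢true⇒≡false λ m → ≡true⇒≢false (All.lookup N-present (memb⁻ m)) v-absent

WF-insNode : ∀ {G v N} → WF G → V G v ≡ false → All (λ u → V G u ≡ true) N →
             WF (apply G (insNode v N))
WF-insNode {G} {v} {N} wf v-absent N-present = record
  { bounded = bounded′ ; symmetric = symmetric′ ; irreflexive = irreflexive′ ; endpoints = endpoints′ }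
  where
  open WF wf
  bounded′ : ∀ w → ((w ≡ᵇ v) ∨ V G w) ≡ true → w < bnd G ⊔ suc v
  bounded′ w e with ∨-true⁻ {w ≡ᵇ v} e
  ... | inj₁ w≡ᵇv rewrite ≡ᵇ-true⇒≡ {w} w≡ᵇv = m≤n⊔m (bnd G) (suc v)
  ... | inj₂ w-present = ≤-trans (bounded w w-present) (m≤m⊔n (bnd G) (suc v))
  symmetric′ : ∀ a b → (E G a b ∨ ((a ≡ᵇ v) ∧ memb b N) ∨ ((b ≡ᵇ v) ∧ memb a N))
                     ≡ (E G b a ∨ ((b ≡ᵇ v) ∧ memb a N) ∨ ((a ≡ᵇ v) ∧ memb b N))
  symmetric′ a b rewrite symmetric a b = cong (E G b a ∨_) (∨-comm ((a ≡ᵇ v) ∧ memb b N) _)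
  no-loop : ∀ w → ((w ≡ᵇ v) ∧ memb w N) ≡ false
  no-loop w = ≢true⇒≡false λ e → let (w≡ᵇv , w∈N) = ∧-true⁻ e in
    ≡true⇒≢false (trans (cong (λ z → memb z N) (sym (≡ᵇ-true⇒≡ {w} w≡ᵇv))) w∈N)
                 (memb-absent {G} N-present v-absent)
  irreflexive′ : ∀ w → (E G w w ∨ ((w ≡ᵇ v) ∧ memb w N) ∨ ((w ≡ᵇ v) ∧ memb w N)) ≡ false
  irreflexive′ w rewrite irreflexive w | no-loop w = refl
  endpoints′ : ∀ a b → (E G a b ∨ ((a ≡ᵇ v) ∧ memb b N) ∨ ((b ≡ᵇ v) ∧ memb a N)) ≡ true →
               ((a ≡ᵇ v) ∨ V G a) ≡ true
  endpoints′ a b e with ∨-true⁻ {E G a b} e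
  ... | inj₁ old = ∨-trueʳ (a ≡ᵇ v) (endpoints a b old)
  ... | inj₂ new with ∨-true⁻ {(a ≡ᵇ v) ∧ memb b N} new
  ... | inj₁ a-new = ∨-trueˡ (V G a) (proj₁ (∧-true⁻ {a ≡ᵇ v} a-new))
  ... | inj₂ b-new = ∨-trueʳ (a ≡ᵇ v) (All.lookup N-present (memb⁻ (proj₂ (∧-true⁻ {b ≡ᵇ v} b-new))))

WF-delNode : ∀ {G} v → WF G → WF (apply G (delNode v))
WF-delNode {G} v wf = record
  { bounded = bounded′ ; symmetric = symmetric′ ; irreflexive = irreflexive′ ; endpoints = endpoints′ }
  where
  open WF wf
  bounded′ : ∀ w → (not (w ≡ᵇ v) ∧ V G w) ≡ true → w < bnd G
  bounded′ w e = bounded w (proj₂ (∧-true⁻ {not (w ≡ᵇ v)} e))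
  symmetric′ : ∀ a b → (not (a ≡ᵇ v) ∧ not (b ≡ᵇ v) ∧ E G a b) ≡ (not (b ≡ᵇ v) ∧ not (a ≡ᵇ v) ∧ E G b a)
  symmetric′ a b rewrite symmetric a b with a ≡ᵇ v | b ≡ᵇ v
  ... | true | true = refl
  ... | true | false = refl
  ... | false | true = refl
  ... | false | false = refl
  irreflexive′ : ∀ w → (not (w ≡ᵇ v) ∧ not (w ≡ᵇ v) ∧ E G w w) ≡ false
  irreflexive′ w rewrite irreflexive w with w ≡ᵇ v
  ... | true = refl
  ... | false = refl
  endpoints′ : ∀ a b → (not (a ≡ᵇ v) ∧ not (b ≡ᵇ v) ∧ E G a b) ≡ true → (not (a ≡ᵇ v) ∧ V G a) ≡ true
  endpoints′ a b e with a≢v , rest ← ∧-true⁻ {not (a ≡ᵇ v)} e =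
    ∧-true⁺ a≢v (endpoints a b (proj₂ (∧-true⁻ {not (b ≡ᵇ v)} rest)))

WF-delEdge : ∀ {G} a b → WF G → WF (apply G (delEdge a b))
WF-delEdge {G} a b wf = record
  { bounded = bounded ; symmetric = symmetric′ ; irreflexive = irreflexive′ ; endpoints = endpoints′ }
  where
  open WF wf
  swap : ∀ P Q R S → ((P ∧ Q) ∨ (R ∧ S)) ≡ ((S ∧ R) ∨ (Q ∧ P))
  swap P Q R S = trans (∨-comm (P ∧ Q) (R ∧ S)) (cong₂ _∨_ (∧-comm R S) (∧-comm P Q))
  symmetric′ : ∀ x y → (E G x y ∧ not (((x ≡ᵇ a) ∧ (y ≡ᵇ b)) ∨ ((x ≡ᵇ b) ∧ (y ≡ᵇ a))))
                     ≡ (E G y x ∧ not (((y ≡ᵇ a) ∧ (x ≡ᵇ b)) ∨ ((y ≡ᵇ b) ∧ (x ≡ᵇ a))))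
  symmetric′ x y rewrite symmetric x y =
    cong (λ z → E G y x ∧ not z) (swap (x ≡ᵇ a) (y ≡ᵇ b) (x ≡ᵇ b) (y ≡ᵇ a))
  irreflexive′ : ∀ w → (E G w w ∧ not (((w ≡ᵇ a) ∧ (w ≡ᵇ b)) ∨ ((w ≡ᵇ b) ∧ (w ≡ᵇ a)))) ≡ false
  irreflexive′ w rewrite irreflexive w = refl
  endpoints′ : ∀ x y → (E G x y ∧ not (((x ≡ᵇ a) ∧ (y ≡ᵇ b)) ∨ ((x ≡ᵇ b) ∧ (y ≡ᵇ a)))) ≡ true →
               V G x ≡ true
  endpoints′ x y e = endpoints x y (proj₁ (∧-true⁻ {E G x y} e))

WF-apply : ∀ {G} ch → WF G → ValidChange G ch → WF (apply G ch)
WF-apply noChange wf _ = wf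
WF-apply (insNode v N) wf (v-absent , N-present) = WF-insNode wf v-absent N-present
WF-apply (delNode v) wf _ = WF-delNode v wf
WF-apply (delEdge a b) wf _ = WF-delEdge a b wf

record NodeState : Set where
  constructor mkState
  field
    self     : ℕ
    lastNbrs : List ℕ
    known    : ℕ → ℕ → Bool
open NodeState

bits : Bool → Bool → Bool → Msg 3
bits a b c = Vec≤.fromVec (a ∷ b ∷ c ∷ [])

bitAt : ℕ → List Bool → Bool
bitAt _ [] = false
bitAt zero (b ∷ _) = b
bitAt (suc i) (_ ∷ bs) = bitAt i bs

bitOf : ℕ → Maybe (Msg 3) → Bool
bitOf i nothing = false
bitOf i (just m) = bitAt i (toList (Vec≤.vec m))

messageFrom : ∀ {M : Set} → ℕ → List (ℕ × M) → Maybe M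
messageFrom q [] = nothing
messageFrom q ((w , m) ∷ ms) = if q ≡ᵇ w then just m else messageFrom q ms

messageFrom-map : ∀ {M : Set} (f : ℕ → M) {q} L → q ∈ L → messageFrom q (map (λ w → w , f w) L) ≡ just (f q)
messageFrom-map f {q} (w ∷ L) q∈ with q ≡ᵇ w in q≡ᵇw
... | true rewrite ≡ᵇ-true⇒≡ {q} q≡ᵇw = refl
messageFrom-map f {q} (w ∷ L) (here refl) | false = ⊥-elim (≡true⇒≢false (≡ᵇ-refl q) q≡ᵇw)
messageFrom-map f {q} (w ∷ L) (there q∈) | false = messageFrom-map f L q∈

received : ℕ → ℕ → List (ℕ × Msg 3) → Bool
received i q ms = bitOf i (messageFrom q ms)

gainedNbr : NodeState → List ℕ → Bool
gainedNbr st L = any (λ w → not (memb w (lastNbrs st))) L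

lostNbr : NodeState → List ℕ → Bool
lostNbr st L = any (λ x → not (memb x L)) (lastNbrs st)

lostNbrAdjTo : NodeState → List ℕ → ℕ → Bool
lostNbrAdjTo st L d = any (λ x → not (memb x L) ∧ known st x d) (lastNbrs st)

message : NodeState → List ℕ → ℕ → Msg 3
message st L d = bits (gainedNbr st L) (lostNbr st L) (lostNbrAdjTo st L d)

isNewNbr : NodeState → List ℕ → ℕ → Bool
isNewNbr st L p = memb p L ∧ not (memb p (lastNbrs st))

insertedEdge : NodeState → List ℕ → List (ℕ × Msg 3) → ℕ → ℕ → Bool
insertedEdge st L ms p q = isNewNbr st L p ∧ not (isNewNbr st L q) ∧ received 0 q ms

deletedEdge : NodeState → List ℕ → List (ℕ × Msg 3) → ℕ → ℕ → Bool
deletedEdge st L ms p q =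
  not (lostNbr st L) ∧ received 1 p ms ∧ received 1 q ms ∧ (received 2 p ms ∨ received 2 q ms)

knownAfter : NodeState → List ℕ → List (ℕ × Msg 3) → ℕ → ℕ → Bool
knownAfter st L ms p q =
  memb p L ∧ memb q L ∧ (known st p q ∨ insertedEdge st L ms p q ∨ insertedEdge st L ms q p)
  ∧ not (deletedEdge st L ms p q)

knowsEdge : NodeState → ℕ → ℕ → Bool
knowsEdge st a b = not (a ≡ᵇ b) ∧
  (((a ≡ᵇ self st) ∧ memb b (lastNbrs st)) ∨ ((b ≡ᵇ self st) ∧ memb a (lastNbrs st)) ∨ known st a b)

inView : NodeState → ℕ → Bool
inView st x = (x ≡ᵇ self st) ∨ memb x (lastNbrs st)

knowsClique : NodeState → List ℕ → Bool
knowsClique st L = all (inView st) L ∧ allPairsᵇ (knowsEdge st) L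

cliqueLister : ℕ → Alg 3
cliqueLister s = record
  { State = NodeState
  ; init = λ u G → mkState u (nbrs G u) (E G)
  ; initNew = λ u → mkState u [] (λ _ _ → false)
  ; msg = message
  ; update = λ st L ms → mkState (self st) L (knownAfter st L ms)
  ; output = λ st → filterᵇ (knowsClique st) (tuples s (self st ∷ lastNbrs st))
  }

BothOlder : (ℕ → ℕ) → ℕ → ℕ → ℕ → Set
BothOlder rank p q v = rank p < rank v × rank q < rank v

ClosedNbr : Graph → ℕ → ℕ → Set
ClosedNbr G u x = x ≡ u ⊎ E G u x ≡ true

record Accurate (G : Graph) (rank : ℕ → ℕ) (v : ℕ) (st : NodeState) : Set where
  field
    self≡          : self st ≡ v
    lastNbrs≡      : lastNbrs st ≡ nbrs G v
    known-sound    : ∀ p q → known st p q ≡ true → E G p q ≡ true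
    known-complete : ∀ p q → E G v p ≡ true → E G v q ≡ true → E G p q ≡ true →
                     ¬ BothOlder rank p q v → known st p q ≡ true

-- rank w is the time at which w was inserted (0 for the nodes of G₀); rankBound exceeds all
-- ranks, so the next inserted node becomes the unique youngest one.
record Invariant (s : ℕ) (G : Graph) (σ : Config (cliqueLister s)) : Set where
  field
    wf         : WF G
    rank       : ℕ → ℕ
    rankBound  : ℕ
    rank<bound : ∀ w → V G w ≡ true → rank w < rankBound
    absent     : ∀ w → V G w ≡ false → σ w ≡ nothing
    present    : ∀ w → V G w ≡ true → Σ NodeState λ st → σ w ≡ just st × Accurate G rank w st

clique-closedNbr : ∀ {G} → WF G → ∀ {u K} → AllPairs (λ a b → E G a b ≡ true) K → u ∈ K →
                   All (ClosedNbr G u) K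
clique-closedNbr {G} wf {u} edges u∈K = All.tabulate closedNbr
  where
  closedNbr : ∀ {x} → x ∈ _ → ClosedNbr G u x
  closedNbr {x} x∈K with x ≟ u
  ... | yes x≡u = inj₁ x≡u
  ... | no x≢u = inj₂ (AllPairs-∈ (E-sym wf) edges u∈K x∈K (x≢u ∘ sym))

module View {G : Graph} (wf : WF G) {rank : ℕ → ℕ} {u : ℕ} {st : NodeState}
            (acc : Accurate G rank u st) where
  open Accurate acc

  memb-lastNbrs : ∀ x → memb x (lastNbrs st) ≡ E G u x
  memb-lastNbrs x = trans (cong (memb x) lastNbrs≡) (memb-nbrs wf u x)

  ≡ᵇself⇒≡ : ∀ {x} → (x ≡ᵇ self st) ≡ true → x ≡ u
  ≡ᵇself⇒≡ {x} e = trans (≡ᵇ-true⇒≡ {x} e) self≡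

  ≡⇒≡ᵇself : ∀ {x} → x ≡ u → (x ≡ᵇ self st) ≡ true
  ≡⇒≡ᵇself {x} refl = subst (λ z → (x ≡ᵇ z) ≡ true) (sym self≡) (≡ᵇ-refl x)

  inView-sound : V G u ≡ true → ∀ {x} → inView st x ≡ true → V G x ≡ true
  inView-sound u-present {x} e with ∨-true⁻ {x ≡ᵇ self st} e
  ... | inj₁ x≡ᵇu = subst (λ z → V G z ≡ true) (sym (≡ᵇself⇒≡ x≡ᵇu)) u-present
  ... | inj₂ x∈ = endpointʳ wf u x (trans (sym (memb-lastNbrs x)) x∈)

  knowsEdge-sound : ∀ {a b} → knowsEdge st a b ≡ true → a ≢ b × E G a b ≡ true
  knowsEdge-sound {a} {b} e with a≢ᵇb , edge ← ∧-true⁻ {not (a ≡ᵇ b)} e =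
    (λ a≡b → ≡true⇒≢false (≡ᵇ-refl a) (subst (λ z → (a ≡ᵇ z) ≡ false) (sym a≡b) (not-true⁻ a≢ᵇb))) ,
    edge-sound edge
    where
    edge-sound : (((a ≡ᵇ self st) ∧ memb b (lastNbrs st)) ∨ ((b ≡ᵇ self st) ∧ memb a (lastNbrs st))
                  ∨ known st a b) ≡ true → E G a b ≡ true
    edge-sound e with ∨-true⁻ {(a ≡ᵇ self st) ∧ memb b (lastNbrs st)} e
    ... | inj₁ a-self with a≡ᵇu , b∈ ← ∧-true⁻ {a ≡ᵇ self st} a-self =
      subst (λ z → E G z b ≡ true) (sym (≡ᵇself⇒≡ a≡ᵇu)) (trans (sym (memb-lastNbrs b)) b∈)
    ... | inj₂ e′ with ∨-true⁻ {(b ≡ᵇ self st) ∧ memb a (lastNbrs st)} e′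
    ... | inj₁ b-self with b≡ᵇu , a∈ ← ∧-true⁻ {b ≡ᵇ self st} b-self =
      E-sym wf (subst (λ z → E G z a ≡ true) (sym (≡ᵇself⇒≡ b≡ᵇu)) (trans (sym (memb-lastNbrs a)) a∈))
    ... | inj₂ k = known-sound a b k

  knowsClique-sound : V G u ≡ true → ∀ L → knowsClique st L ≡ true →
    Unique L × All (λ x → V G x ≡ true) L × AllPairs (λ a b → E G a b ≡ true) L
  knowsClique-sound u-present L e with viewed , edges ← ∧-true⁻ {all (inView st) L} e =
    AllPairs.map proj₁ pairs , All.map (inView-sound u-present) (all-true⁻ (inView st) L viewed) ,
    AllPairs.map proj₂ pairs
    where
    pairs = AllPairs.map knowsEdge-sound (allPairsᵇ-true⁻ (knowsEdge st) L edges)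

  closedNbr-inView : ∀ {x} → ClosedNbr G u x → inView st x ≡ true
  closedNbr-inView (inj₁ x≡u) = ∨-trueˡ _ (≡⇒≡ᵇself x≡u)
  closedNbr-inView {x} (inj₂ e) = ∨-trueʳ (x ≡ᵇ self st) (trans (memb-lastNbrs x) e)

  closedNbr-∈ : ∀ {x} → ClosedNbr G u x → x ∈ self st ∷ lastNbrs st
  closedNbr-∈ (inj₁ refl) = here (sym self≡)
  closedNbr-∈ {x} (inj₂ e) = there (memb⁻ (trans (memb-lastNbrs x) e))

  knowsEdge-complete : ∀ {x y} → ClosedNbr G u x × rank u ≤ rank x → ClosedNbr G u y × rank u ≤ rank y →
                       x ≢ y × E G x y ≡ true → knowsEdge st x y ≡ true
  knowsEdge-complete {x} {y} (x-near , u≤x) (y-near , u≤y) (x≢y , exy) =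
    ∧-true⁺ (not-true⁺ (≢⇒≡ᵇ-false x≢y)) (by-cases x-near y-near)
    where
    by-cases : ClosedNbr G u x → ClosedNbr G u y →
      (((x ≡ᵇ self st) ∧ memb y (lastNbrs st)) ∨ ((y ≡ᵇ self st) ∧ memb x (lastNbrs st))
        ∨ known st x y) ≡ true
    by-cases (inj₁ refl) _ = ∨-trueˡ _ (∧-true⁺ (≡⇒≡ᵇself refl) (trans (memb-lastNbrs y) exy))
    by-cases (inj₂ _) (inj₁ refl) = ∨-trueʳ ((x ≡ᵇ self st) ∧ memb y (lastNbrs st))
      (∨-trueˡ _ (∧-true⁺ (≡⇒≡ᵇself refl) (trans (memb-lastNbrs x) (E-sym wf exy))))
    by-cases (inj₂ eux) (inj₂ euy) = ∨-trueʳ ((x ≡ᵇ self st) ∧ memb y (lastNbrs st))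
      (∨-trueʳ ((y ≡ᵇ self st) ∧ memb x (lastNbrs st))
        (known-complete x y eux euy exy (λ (x<u , _) → ≤⇒≯ u≤x x<u)))

  knowsClique-complete : ∀ {K} → All (λ x → ClosedNbr G u x × rank u ≤ rank x) K → Unique K →
                         AllPairs (λ a b → E G a b ≡ true) K → knowsClique st K ≡ true
  knowsClique-complete near uniq edges =
    ∧-true⁺ (all-true⁺ (inView st) (All.map (closedNbr-inView ∘ proj₁) near))
            (allPairsᵇ-true⁺ (knowsEdge st)
              (AllPairs-mapWithAll knowsEdge-complete near (AllPairs.zip (uniq , edges))))

module Listing {s : ℕ} {G : Graph} {σ : Config (cliqueLister s)} (I : Invariant s G σ) where
  open Invariant I

  present-accurate : ∀ {v st} → σ v ≡ just st → V G v ≡ true × Accurate G rank v st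
  present-accurate {v} e with V G v in v-present
  ... | false with () ← trans (sym (absent v v-present)) e
  ... | true with st′ , e′ , acc ← present v v-present rewrite just-injective (trans (sym e) e′) = refl , acc

  listed-isClique : ∀ v st → σ v ≡ just st → ∀ L → L ∈ output (cliqueLister s) st → IsClique s G L
  listed-isClique v st e L L∈
    with v-present , acc ← present-accurate e
       | L∈tuples , knows ← ∈-filterᵇ⁻ (knowsClique st) (tuples s (self st ∷ lastNbrs st)) L∈ =
    tuples-length s _ L∈tuples , View.knowsClique-sound wf acc v-present L knows

  oldest-lists : ∀ {K u st} → IsClique s G K → u ∈ K → All (λ x → rank u ≤ rank x) K →
                 Accurate G rank u st → K ∈ output (cliqueLister s) st
  oldest-lists {K} {u} {st} (len , uniq , _ , edges) u∈K oldest acc =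
    ∈-filterᵇ⁺ (knowsClique st)
      (subst (λ n → K ∈ tuples n _) len (∈-tuples _ (All.map closedNbr-∈ near)))
      (knowsClique-complete (All.zip (near , oldest)) uniq edges)
    where
    open View wf acc
    near = clique-closedNbr wf edges u∈K

  clique-listed : 1 ≤ s → ∀ K → IsClique s G K →
    ∃[ v ] (v ∈ K × ∃[ st ] (σ v ≡ just st × ∃[ L ] (L ∈ output (cliqueLister s) st × L ↭ K)))
  clique-listed 1≤s [] (len , _) with () ← subst (1 ≤_) (sym len) 1≤s
  clique-listed _ (k ∷ K) clique@(_ , _ , K-present , _)
    with st , e , acc ← present (argmin rank k K) (All.lookup K-present (argmin-∈ rank k K)) =
    argmin rank k K , argmin-∈ rank k K , st , e , k ∷ K ,
    oldest-lists clique (argmin-∈ rank k K) (argmin-minimal rank k K) acc , ↭-refl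

  correct : 1 ≤ s → Correct (cliqueLister s) s G σ
  correct 1≤s = listed-isClique , clique-listed 1≤s

module Round {s : ℕ} {G : Graph} {σ : Config (cliqueLister s)} (I : Invariant s G σ)
             (ch : Change) (vc : ValidChange G ch) where
  open Invariant I

  G′ : Graph
  G′ = apply G ch

  wf′ : WF G′
  wf′ = WF-apply ch wf vc

  σ′ : Config (cliqueLister s)
  σ′ = round (cliqueLister s) G′ σ

  prevState : ℕ → NodeState
  prevState w = fromMaybe (mkState w [] (λ _ _ → false)) (σ w)

  inbox : ℕ → List (ℕ × Msg 3)
  inbox u = map (λ w → w , message (prevState w) (nbrs G′ w) u) (nbrs G′ u)

  knows′ insertedAt deletedAt : ℕ → ℕ → ℕ → Bool
  knows′ u = knownAfter (prevState u) (nbrs G′ u) (inbox u)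
  insertedAt u = insertedEdge (prevState u) (nbrs G′ u) (inbox u)
  deletedAt u = deletedEdge (prevState u) (nbrs G′ u) (inbox u)

  gains loses : ℕ → Bool
  gains q = gainedNbr (prevState q) (nbrs G′ q)
  loses q = lostNbr (prevState q) (nbrs G′ q)

  losesNbrAdjTo : ℕ → ℕ → Bool
  losesNbrAdjTo q d = lostNbrAdjTo (prevState q) (nbrs G′ q) d

  prevState-accurate : ∀ w → V G w ≡ true → Accurate G rank w (prevState w)
  prevState-accurate w w-present with st , e , acc ← present w w-present rewrite e = acc

  prevState-new : ∀ w → V G w ≡ false → prevState w ≡ mkState w [] (λ _ _ → false)
  prevState-new w w-absent rewrite absent w w-absent = refl

  self-prevState : ∀ w → self (prevState w) ≡ w
  self-prevState w with V G w in w∈G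
  ... | true = Accurate.self≡ (prevState-accurate w w∈G)
  ... | false rewrite prevState-new w w∈G = refl

  prevKnown-sound : ∀ u p q → known (prevState u) p q ≡ true → V G u ≡ true × E G p q ≡ true
  prevKnown-sound u p q k with V G u in u∈G
  ... | true = refl , Accurate.known-sound (prevState-accurate u u∈G) p q k
  ... | false with () ← trans (sym (cong (λ st → known st p q) (prevState-new u u∈G))) k

  messageFrom-inbox : ∀ {u q} → q ∈ nbrs G′ u →
                      messageFrom q (inbox u) ≡ just (message (prevState q) (nbrs G′ q) u)
  messageFrom-inbox {u} = messageFrom-map (λ w → message (prevState w) (nbrs G′ w) u) (nbrs G′ u)

  received-gains : ∀ {u q} → q ∈ nbrs G′ u → received 0 q (inbox u) ≡ gains q
  received-gains q∈ = cong (bitOf 0) (messageFrom-inbox q∈)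

  received-loses : ∀ {u q} → q ∈ nbrs G′ u → received 1 q (inbox u) ≡ loses q
  received-loses q∈ = cong (bitOf 1) (messageFrom-inbox q∈)

  received-losesNbrAdjTo : ∀ {u q} → q ∈ nbrs G′ u → received 2 q (inbox u) ≡ losesNbrAdjTo q u
  received-losesNbrAdjTo q∈ = cong (bitOf 2) (messageFrom-inbox q∈)

  memb-prev : ∀ q w → V G q ≡ true → memb w (lastNbrs (prevState q)) ≡ E G q w
  memb-prev q w q∈G = View.memb-lastNbrs wf (prevState-accurate q q∈G) w

  ∈-prev⁻ : ∀ q x → V G q ≡ true → x ∈ lastNbrs (prevState q) → E G q x ≡ true
  ∈-prev⁻ q x q∈G x∈ = trans (sym (memb-prev q x q∈G)) (memb⁺ x∈)

  ∈-prev⁺ : ∀ q x → V G q ≡ true → E G q x ≡ true → x ∈ lastNbrs (prevState q)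
  ∈-prev⁺ q x q∈G e = memb⁻ (trans (memb-prev q x q∈G) e)

  gains⁻ : ∀ q → V G q ≡ true → gains q ≡ true → ∃[ w ] (E G′ q w ≡ true × E G q w ≡ false)
  gains⁻ q q∈G e with w , w∈ , new ← any-true⁻ _ (nbrs G′ q) e =
    w , ∈-nbrs⁻ wf′ w∈ , trans (sym (memb-prev q w q∈G)) (not-true⁻ new)

  gains⁺ : ∀ q w → V G q ≡ true → E G′ q w ≡ true → E G q w ≡ false → gains q ≡ true
  gains⁺ q w q∈G e′ e = any-true⁺ _ (∈-nbrs⁺ wf′ e′) (not-true⁺ (trans (memb-prev q w q∈G) e))

  loses⁻ : ∀ q → V G q ≡ true → loses q ≡ true → ∃[ x ] (E G q x ≡ true × E G′ q x ≡ false)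
  loses⁻ q q∈G e with x , x∈ , gone ← any-true⁻ _ (lastNbrs (prevState q)) e =
    x , ∈-prev⁻ q x q∈G x∈ , trans (sym (memb-nbrs wf′ q x)) (not-true⁻ gone)

  loses⁺ : ∀ q x → V G q ≡ true → E G q x ≡ true → E G′ q x ≡ false → loses q ≡ true
  loses⁺ q x q∈G e e′ = any-true⁺ _ (∈-prev⁺ q x q∈G e) (not-true⁺ (trans (memb-nbrs wf′ q x) e′))

  losesNbrAdjTo⁻ : ∀ q d → V G q ≡ true → losesNbrAdjTo q d ≡ true →
                   ∃[ x ] (E G q x ≡ true × E G′ q x ≡ false × E G x d ≡ true)
  losesNbrAdjTo⁻ q d q∈G e with x , x∈ , h ← any-true⁻ _ (lastNbrs (prevState q)) e
                            with gone , k ← ∧-true⁻ {not (memb x (nbrs G′ q))} h =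
    x , ∈-prev⁻ q x q∈G x∈ , trans (sym (memb-nbrs wf′ q x)) (not-true⁻ gone) ,
    Accurate.known-sound (prevState-accurate q q∈G) x d k

  losesNbrAdjTo⁺ : ∀ q x d → V G q ≡ true → E G q x ≡ true → E G′ q x ≡ false →
                   known (prevState q) x d ≡ true → losesNbrAdjTo q d ≡ true
  losesNbrAdjTo⁺ q x d q∈G e e′ k =
    any-true⁺ _ (∈-prev⁺ q x q∈G e) (∧-true⁺ (not-true⁺ (trans (memb-nbrs wf′ q x) e′)) k)

  losesNbrAdjTo-none : (∀ {x y} → E G x y ≡ true → E G′ x y ≡ true) → ∀ r d → losesNbrAdjTo r d ≡ false
  losesNbrAdjTo-none grow r d with V G r in r∈G
  ... | false rewrite prevState-new r r∈G = refl
  ... | true = ≢true⇒≡false λ e → let (x , old , gone , _) = losesNbrAdjTo⁻ r d r∈G e in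
                                  ≡true⇒≢false (grow old) gone

  knows′⁻ : ∀ u p q → knows′ u p q ≡ true →
    E G′ u p ≡ true × E G′ u q ≡ true ×
    (known (prevState u) p q ∨ insertedAt u p q ∨ insertedAt u q p) ≡ true × deletedAt u p q ≡ false
  knows′⁻ u p q e =
    let (p∈ , e₁) = ∧-true⁻ {memb p (nbrs G′ u)} e
        (q∈ , e₂) = ∧-true⁻ {memb q (nbrs G′ u)} e₁
        (k , d) = ∧-true⁻ {known (prevState u) p q ∨ insertedAt u p q ∨ insertedAt u q p} e₂
    in trans (sym (memb-nbrs wf′ u p)) p∈ , trans (sym (memb-nbrs wf′ u q)) q∈ , k , not-true⁻ d

  knows′⁺ : ∀ u p q → E G′ u p ≡ true → E G′ u q ≡ true →
    (known (prevState u) p q ∨ insertedAt u p q ∨ insertedAt u q p) ≡ true → deletedAt u p q ≡ false →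
    knows′ u p q ≡ true
  knows′⁺ u p q eup euq k d =
    ∧-true⁺ (trans (memb-nbrs wf′ u p) eup) (∧-true⁺ (trans (memb-nbrs wf′ u q) euq) (∧-true⁺ k (not-true⁺ d)))

  insertedAt⁻ : ∀ u p q → V G u ≡ true → E G′ u q ≡ true → insertedAt u p q ≡ true →
    E G′ u p ≡ true × E G u p ≡ false × E G u q ≡ true × gains q ≡ true
  insertedAt⁻ u p q u∈G euq e =
    let (p-new , e₁) = ∧-true⁻ {isNewNbr (prevState u) (nbrs G′ u) p} e
        (q-old , g) = ∧-true⁻ {not (isNewNbr (prevState u) (nbrs G′ u) q)} e₁
        (p∈ , p∉prev) = ∧-true⁻ {memb p (nbrs G′ u)} p-new
        q-new : isNewNbr (prevState u) (nbrs G′ u) q ≡ not (E G u q)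
        q-new = cong₂ (λ a b → a ∧ not b) (trans (memb-nbrs wf′ u q) euq) (memb-prev u q u∈G)
    in trans (sym (memb-nbrs wf′ u p)) p∈ , trans (sym (memb-prev u p u∈G)) (not-true⁻ p∉prev) ,
       ≢false⇒≡true (λ h → ≡true⇒≢false (trans q-new (cong not h)) (not-true⁻ q-old)) ,
       trans (sym (received-gains (∈-nbrs⁺ wf′ euq))) g

  insertedAt-new : ∀ u p q → V G u ≡ false → E G′ u q ≡ true → insertedAt u p q ≡ false
  insertedAt-new u p q u∉G euq = ≢true⇒≡false λ e →
    ≡true⇒≢false (proj₁ (∧-true⁻ {not (isNewNbr (prevState u) (nbrs G′ u) q)}
                     (proj₂ (∧-true⁻ {isNewNbr (prevState u) (nbrs G′ u) p} e)))) (cong not q-new)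
    where
    q-new : isNewNbr (prevState u) (nbrs G′ u) q ≡ true
    q-new = cong₂ (λ a st → a ∧ not (memb q (lastNbrs st)))
                  (trans (memb-nbrs wf′ u q) euq) (prevState-new u u∉G)

  insertedAt⁺ : ∀ u p q → V G u ≡ true → E G′ u p ≡ true → E G u p ≡ false → E G′ u q ≡ true →
    E G u q ≡ true → gains q ≡ true → insertedAt u p q ≡ true
  insertedAt⁺ u p q u∈G eup′ eup euq′ euq g =
    ∧-true⁺ (∧-true⁺ (trans (memb-nbrs wf′ u p) eup′) (not-true⁺ (trans (memb-prev u p u∈G) eup)))
      (∧-true⁺ (not-true⁺ (≢true⇒≡false λ h →
                  ≡true⇒≢false (trans (memb-prev u q u∈G) euq)
                               (not-true⁻ (proj₂ (∧-true⁻ {memb q (nbrs G′ u)} h)))))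
               (trans (received-gains (∈-nbrs⁺ wf′ euq′)) g))

  deletedAt⁻ : ∀ u p q → E G′ u p ≡ true → E G′ u q ≡ true → deletedAt u p q ≡ true →
    loses u ≡ false × loses p ≡ true × loses q ≡ true × (losesNbrAdjTo p u ∨ losesNbrAdjTo q u) ≡ true
  deletedAt⁻ u p q eup euq e =
    let p∈ = ∈-nbrs⁺ wf′ eup
        q∈ = ∈-nbrs⁺ wf′ euq
        (u-keeps , e₁) = ∧-true⁻ {not (loses u)} e
        (p-loses , e₂) = ∧-true⁻ {received 1 p (inbox u)} e₁
        (q-loses , adj) = ∧-true⁻ {received 1 q (inbox u)} e₂
    in not-true⁻ u-keeps , trans (sym (received-loses p∈)) p-loses , trans (sym (received-loses q∈)) q-loses ,
       trans (sym (cong₂ _∨_ (received-losesNbrAdjTo p∈) (received-losesNbrAdjTo q∈))) adj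

  deletedAt⁺ : ∀ u p q → E G′ u p ≡ true → E G′ u q ≡ true →
    loses u ≡ false → loses p ≡ true → loses q ≡ true → (losesNbrAdjTo p u ∨ losesNbrAdjTo q u) ≡ true →
    deletedAt u p q ≡ true
  deletedAt⁺ u p q eup euq u-keeps p-loses q-loses adj =
    let p∈ = ∈-nbrs⁺ wf′ eup
        q∈ = ∈-nbrs⁺ wf′ euq
    in ∧-true⁺ (not-true⁺ u-keeps)
         (∧-true⁺ (trans (received-loses p∈) p-loses)
           (∧-true⁺ (trans (received-loses q∈) q-loses)
             (trans (cong₂ _∨_ (received-losesNbrAdjTo p∈) (received-losesNbrAdjTo q∈)) adj)))

  deletedAt-none : (∀ {x y} → E G x y ≡ true → E G′ x y ≡ true) →
                   ∀ u p q → E G′ u p ≡ true → E G′ u q ≡ true → deletedAt u p q ≡ false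
  deletedAt-none grow u p q eup euq = ≢true⇒≡false λ e →
    ≡true⇒≢false (proj₂ (proj₂ (proj₂ (deletedAt⁻ u p q eup euq e))))
                 (cong₂ _∨_ (losesNbrAdjTo-none grow p u) (losesNbrAdjTo-none grow q u))

  KnownSound : ℕ → Set
  KnownSound u = ∀ p q → knows′ u p q ≡ true → E G′ p q ≡ true

  KnownComplete : (ℕ → ℕ) → ℕ → Set
  KnownComplete rank′ u = ∀ p q → E G′ u p ≡ true → E G′ u q ≡ true → E G′ p q ≡ true →
                          ¬ BothOlder rank′ p q u → knows′ u p q ≡ true

  invariant′ : (rank′ : ℕ → ℕ) (bound′ : ℕ) → (∀ w → V G′ w ≡ true → rank′ w < bound′) →
               (∀ u → V G′ u ≡ true → KnownSound u × KnownComplete rank′ u) → Invariant s G′ σ′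
  invariant′ rank′ bound′ rank′<bound′ known′ = record
    { wf = wf′ ; rank = rank′ ; rankBound = bound′ ; rank<bound = rank′<bound′
    ; absent = absent′ ; present = present′ }
    where
    absent′ : ∀ w → V G′ w ≡ false → σ′ w ≡ nothing
    absent′ w w∉G′ rewrite w∉G′ = refl
    present′ : ∀ w → V G′ w ≡ true → Σ NodeState λ st → σ′ w ≡ just st × Accurate G′ rank′ w st
    present′ w w∈G′ rewrite w∈G′ = _ , refl , record
      { self≡ = self-prevState w ; lastNbrs≡ = refl
      ; known-sound = proj₁ (known′ w w∈G′) ; known-complete = proj₂ (known′ w w∈G′) }

  DeletionsNoticed SurvivorsKept : Set
  DeletionsNoticed = ∀ u p q → E G′ u p ≡ true → E G′ u q ≡ true → E G p q ≡ true →
                     deletedAt u p q ≡ false → E G′ p q ≡ true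
  SurvivorsKept = ∀ u p q → E G′ u p ≡ true → E G′ u q ≡ true → E G′ p q ≡ true → deletedAt u p q ≡ false

  module Shrinking (V-shrink : ∀ {w} → V G′ w ≡ true → V G w ≡ true)
                   (E-shrink : ∀ {x y} → E G′ x y ≡ true → E G x y ≡ true) where

    knows′⇒known : ∀ u p q → knows′ u p q ≡ true →
      E G′ u p ≡ true × E G′ u q ≡ true × E G p q ≡ true × deletedAt u p q ≡ false
    knows′⇒known u p q e with eup , euq , k , d ← knows′⁻ u p q e
                         with ∨-true⁻ {known (prevState u) p q} k
    ... | inj₁ k = eup , euq , proj₂ (prevKnown-sound u p q k) , d
    ... | inj₂ ins = ⊥-elim ([ new-p , new-q ] (∨-true⁻ {insertedAt u p q} ins))
      where
      u∈G = WF.endpoints wf u p (E-shrink eup)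
      new-p : insertedAt u p q ≡ true → ⊥
      new-p i = ≡true⇒≢false (E-shrink eup) (proj₁ (proj₂ (insertedAt⁻ u p q u∈G euq i)))
      new-q : insertedAt u q p ≡ true → ⊥
      new-q i = ≡true⇒≢false (E-shrink euq) (proj₁ (proj₂ (insertedAt⁻ u q p u∈G eup i)))

    shrinking-invariant : DeletionsNoticed → SurvivorsKept → Invariant s G′ σ′
    shrinking-invariant deletions-noticed survivors-kept =
      invariant′ rank rankBound (λ w w∈G′ → rank<bound w (V-shrink w∈G′))
                 λ u u∈G′ → sound u , complete u u∈G′
      where
      sound : ∀ u → KnownSound u
      sound u p q e with eup , euq , epq , d ← knows′⇒known u p q e = deletions-noticed u p q eup euq epq d
      complete : ∀ u → V G′ u ≡ true → KnownComplete rank u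
      complete u u∈G′ p q eup euq epq not-older =
        knows′⁺ u p q eup euq
          (∨-trueˡ _ (Accurate.known-complete (prevState-accurate u (V-shrink u∈G′)) p q
                        (E-shrink eup) (E-shrink euq) (E-shrink epq) not-older))
          (survivors-kept u p q eup euq epq)

module NoChange {s : ℕ} {G : Graph} {σ : Config (cliqueLister s)} (I : Invariant s G σ) where
  open Round I noChange tt
  open Shrinking (λ w∈G → w∈G) (λ e → e)

  invariant : Invariant s G σ′
  invariant = shrinking-invariant (λ _ _ _ _ _ epq _ → epq)
                                  (λ u p q eup euq _ → deletedAt-none (λ e → e) u p q eup euq)

module InsNode {s : ℕ} {G : Graph} {σ : Config (cliqueLister s)} (I : Invariant s G σ)
               (v : ℕ) (N : List ℕ) (vc : ValidChange G (insNode v N)) where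
  open Invariant I
  open Round I (insNode v N) vc

  E-grow : ∀ {x y} → E G x y ≡ true → E G′ x y ≡ true
  E-grow e = ∨-trueˡ _ e

  E-old : ∀ {x y} → E G′ x y ≡ true → x ≢ v → y ≢ v → E G x y ≡ true
  E-old {x} {y} e x≢v y≢v with ∨-true⁻ {E G x y} e
  ... | inj₁ old = old
  ... | inj₂ new with ∨-true⁻ {(x ≡ᵇ v) ∧ memb y N} new
  ... | inj₁ x-new = ⊥-elim (x≢v (≡ᵇ-true⇒≡ {x} (proj₁ (∧-true⁻ {x ≡ᵇ v} x-new))))
  ... | inj₂ y-new = ⊥-elim (y≢v (≡ᵇ-true⇒≡ {y} (proj₁ (∧-true⁻ {y ≡ᵇ v} y-new))))

  present⇒≢v : ∀ {w} → V G w ≡ true → w ≢ v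
  present⇒≢v w∈G refl = ≡true⇒≢false w∈G (proj₁ vc)

  V′⁻ : ∀ {w} → V G′ w ≡ true → w ≡ v ⊎ V G w ≡ true
  V′⁻ {w} e with ∨-true⁻ {w ≡ᵇ v} e
  ... | inj₁ w≡ᵇv = inj₁ (≡ᵇ-true⇒≡ {w} w≡ᵇv)
  ... | inj₂ w∈G = inj₂ w∈G

  new-edge⇒v : ∀ {u p} → V G u ≡ true → E G′ u p ≡ true → E G u p ≡ false → p ≡ v
  new-edge⇒v {u} {p} u∈G e′ e with p ≟ v
  ... | yes p≡v = p≡v
  ... | no p≢v = ⊥-elim (≡true⇒≢false (E-old e′ (present⇒≢v u∈G) p≢v) e)

  not-adjacent-to-v : ∀ x → E G x v ≡ false
  not-adjacent-to-v x = ≢true⇒≡false λ e → ≡true⇒≢false (endpointʳ wf x v e) (proj₁ vc)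

  rank′ : ℕ → ℕ
  rank′ w = if w ≡ᵇ v then rankBound else rank w

  rank′-old : ∀ {w} → V G w ≡ true → rank′ w ≡ rank w
  rank′-old w∈G rewrite ≢⇒≡ᵇ-false (present⇒≢v w∈G) = refl

  rank′-v : rank′ v ≡ rankBound
  rank′-v rewrite ≡ᵇ-refl v = refl

  rank′<bound : ∀ w → V G′ w ≡ true → rank′ w < suc rankBound
  rank′<bound w w∈G′ with V′⁻ w∈G′
  ... | inj₁ refl rewrite rank′-v = n<1+n rankBound
  ... | inj₂ w∈G rewrite rank′-old w∈G = <-trans (rank<bound w w∈G) (n<1+n rankBound)

  bothOlder′ : ∀ {p q u} → V G p ≡ true → V G q ≡ true → V G u ≡ true →
               BothOlder rank p q u → BothOlder rank′ p q u
  bothOlder′ p∈G q∈G u∈G (p<u , q<u) =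
    subst₂ _<_ (sym (rank′-old p∈G)) (sym (rank′-old u∈G)) p<u ,
    subst₂ _<_ (sym (rank′-old q∈G)) (sym (rank′-old u∈G)) q<u

  newcomer-youngest : ∀ x → E G′ v x ≡ true → rank′ x < rank′ v
  newcomer-youngest x e with V′⁻ (endpointʳ wf′ v x e)
  ... | inj₁ x≡v = ⊥-elim (E⇒≢ wf′ e (sym x≡v))
  ... | inj₂ x∈G rewrite rank′-old x∈G | rank′-v = rank<bound x x∈G

  inserted⇒edge : ∀ u p q → V G u ≡ true → E G′ u p ≡ true → E G′ u q ≡ true → insertedAt u p q ≡ true →
                  E G′ p q ≡ true
  inserted⇒edge u p q u∈G eup euq i
    with _ , eup-new , euq-old , g ← insertedAt⁻ u p q u∈G euq i
    with refl ← new-edge⇒v u∈G eup eup-new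
    with w , eqw′ , eqw ← gains⁻ q (endpointʳ wf u q euq-old) g
    with refl ← new-edge⇒v (endpointʳ wf u q euq-old) eqw′ eqw = E-sym wf′ eqw′

  sound : ∀ u → KnownSound u
  sound u p q e with eup , euq , k , _ ← knows′⁻ u p q e with ∨-true⁻ {known (prevState u) p q} k
  ... | inj₁ k = E-grow (proj₂ (prevKnown-sound u p q k))
  ... | inj₂ ins with V G u in u∈G
  ... | false = ⊥-elim ([ (λ i → ≡true⇒≢false i (insertedAt-new u p q u∈G euq))
                        , (λ i → ≡true⇒≢false i (insertedAt-new u q p u∈G eup)) ]
                        (∨-true⁻ {insertedAt u p q} ins))
  ... | true = [ inserted⇒edge u p q u∈G eup euq , E-sym wf′ ∘ inserted⇒edge u q p u∈G euq eup ]
                 (∨-true⁻ {insertedAt u p q} ins)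

  complete-old : ∀ u → V G u ≡ true → ∀ p q → E G′ u p ≡ true → E G′ u q ≡ true → E G′ p q ≡ true →
    ¬ BothOlder rank′ p q u → (known (prevState u) p q ∨ insertedAt u p q ∨ insertedAt u q p) ≡ true
  complete-old u u∈G p q eup euq epq not-older with ≡true⊎≡false (E G u p) | ≡true⊎≡false (E G u q)
  ... | inj₁ eup-old | inj₁ euq-old =
    let p∈G = endpointʳ wf u p eup-old
        q∈G = endpointʳ wf u q euq-old
    in ∨-trueˡ _ (Accurate.known-complete (prevState-accurate u u∈G) p q eup-old euq-old
                    (E-old epq (present⇒≢v p∈G) (present⇒≢v q∈G)) (not-older ∘ bothOlder′ p∈G q∈G u∈G))
  ... | inj₂ eup-old | _ with refl ← new-edge⇒v u∈G eup eup-old =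
    let euq-old′ = E-old euq (present⇒≢v u∈G) (λ q≡v → E⇒≢ wf′ epq (sym q≡v))
    in ∨-trueʳ (known (prevState u) v q) (∨-trueˡ _ (insertedAt⁺ u v q u∈G eup eup-old euq euq-old′
         (gains⁺ q v (endpointʳ wf u q euq-old′) (E-sym wf′ epq) (not-adjacent-to-v q))))
  ... | inj₁ eup-old | inj₂ euq-old with refl ← new-edge⇒v u∈G euq euq-old =
    ∨-trueʳ (known (prevState u) p v) (∨-trueʳ (insertedAt u p v)
      (insertedAt⁺ u v p u∈G euq euq-old eup eup-old (gains⁺ p v (endpointʳ wf u p eup-old) epq (not-adjacent-to-v p))))

  complete-new : ∀ u → V G′ u ≡ true → V G u ≡ false → ∀ p q → E G′ u p ≡ true → E G′ u q ≡ true →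
                 ¬ ¬ BothOlder rank′ p q u
  complete-new u u∈G′ u∉G p q eup euq not-older with V′⁻ u∈G′
  ... | inj₂ u∈G = ≡true⇒≢false u∈G u∉G
  ... | inj₁ refl = not-older (newcomer-youngest p eup , newcomer-youngest q euq)

  complete : ∀ u → V G′ u ≡ true → KnownComplete rank′ u
  complete u u∈G′ p q eup euq epq not-older with ≡true⊎≡false (V G u)
  ... | inj₁ u∈G = knows′⁺ u p q eup euq (complete-old u u∈G p q eup euq epq not-older)
                             (deletedAt-none E-grow u p q eup euq)
  ... | inj₂ u∉G = ⊥-elim (complete-new u u∈G′ u∉G p q eup euq not-older)

  invariant : Invariant s G′ σ′
  invariant = invariant′ rank′ (suc rankBound) rank′<bound λ u u∈G′ → sound u , complete u u∈G′

module DelNode {s : ℕ} {G : Graph} {σ : Config (cliqueLister s)} (I : Invariant s G σ)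
               (v : ℕ) (vc : ValidChange G (delNode v)) where
  open Invariant I
  open Round I (delNode v) vc

  V-shrink : ∀ {w} → V G′ w ≡ true → V G w ≡ true
  V-shrink {w} e = proj₂ (∧-true⁻ {not (w ≡ᵇ v)} e)

  E-shrink : ∀ {x y} → E G′ x y ≡ true → E G x y ≡ true
  E-shrink {x} {y} e = proj₂ (∧-true⁻ {not (y ≡ᵇ v)} (proj₂ (∧-true⁻ {not (x ≡ᵇ v)} e)))

  open Shrinking V-shrink E-shrink

  not-adjacent-to-v : ∀ x → E G′ x v ≡ false
  not-adjacent-to-v x = ≢true⇒≡false λ e →
    ≡true⇒≢false (≡ᵇ-refl v) (not-true⁻ (proj₁ (∧-true⁻ {not (v ≡ᵇ v)} (proj₂ (∧-true⁻ {not (x ≡ᵇ v)} e)))))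

  lost-edge⇒v : ∀ {x y} → E G x y ≡ true → E G′ x y ≡ false → x ≡ v ⊎ y ≡ v
  lost-edge⇒v {x} {y} e e′ with x ≟ v | y ≟ v
  ... | yes x≡v | _ = inj₁ x≡v
  ... | no _ | yes y≡v = inj₂ y≡v
  ... | no x≢v | no y≢v rewrite ≢⇒≡ᵇ-false x≢v | ≢⇒≡ᵇ-false y≢v = ⊥-elim (≡true⇒≢false e e′)

  deletions-noticed : DeletionsNoticed
  deletions-noticed u p q eup euq epq _ = ≢false⇒≡true λ epq′ →
    [ (λ p≡v → ≡true⇒≢false (subst (λ z → E G′ u z ≡ true) p≡v eup) (not-adjacent-to-v u))
    , (λ q≡v → ≡true⇒≢false (subst (λ z → E G′ u z ≡ true) q≡v euq) (not-adjacent-to-v u)) ]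
    (lost-edge⇒v epq epq′)

  report⇒loses : ∀ u x → E G′ u x ≡ true → losesNbrAdjTo x u ≡ true → loses u ≡ true
  report⇒loses u x eux adj
    with y , exy , exy′ , eyu ← losesNbrAdjTo⁻ x u (endpointʳ wf u x (E-shrink eux)) adj
    with lost-edge⇒v exy exy′
  ... | inj₁ x≡v = ⊥-elim (≡true⇒≢false (subst (λ z → E G′ u z ≡ true) x≡v eux) (not-adjacent-to-v u))
  ... | inj₂ y≡v = loses⁺ u v (V-shrink (WF.endpoints wf′ u x eux))
                     (E-sym wf (subst (λ z → E G z u ≡ true) y≡v eyu)) (not-adjacent-to-v u)

  survivors-kept : SurvivorsKept
  survivors-kept u p q eup euq _ = ≢true⇒≡false λ e →
    let (u-keeps , _ , _ , adj) = deletedAt⁻ u p q eup euq e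
    in ≡true⇒≢false ([ report⇒loses u p eup , report⇒loses u q euq ] (∨-true⁻ adj)) u-keeps

  invariant : Invariant s G′ σ′
  invariant = shrinking-invariant deletions-noticed survivors-kept

module DelEdge {s : ℕ} {G : Graph} {σ : Config (cliqueLister s)} (I : Invariant s G σ)
               (a b : ℕ) (vc : ValidChange G (delEdge a b)) where
  open Invariant I
  open Round I (delEdge a b) vc

  E-shrink : ∀ {x y} → E G′ x y ≡ true → E G x y ≡ true
  E-shrink {x} {y} e = proj₁ (∧-true⁻ {E G x y} e)

  open Shrinking (λ w∈G → w∈G) E-shrink

  End : ℕ → Set
  End w = w ≡ a ⊎ w ≡ b

  E′-sym : ∀ {x y} → E G′ x y ≡ false → E G′ y x ≡ false
  E′-sym {x} {y} e′ = trans (WF.symmetric wf′ y x) e′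

  lost-edge⇒ends : ∀ {x y} → E G x y ≡ true → E G′ x y ≡ false → (x ≡ a × y ≡ b) ⊎ (x ≡ b × y ≡ a)
  lost-edge⇒ends {x} {y} e e′ with (x ≡ᵇ a) ∧ (y ≡ᵇ b) in xy≡ab | (x ≡ᵇ b) ∧ (y ≡ᵇ a) in xy≡ba
  ... | true | _ = let (x≡a , y≡b) = ∧-true⁻ {x ≡ᵇ a} xy≡ab in inj₁ (≡ᵇ-true⇒≡ x≡a , ≡ᵇ-true⇒≡ y≡b)
  ... | false | true = let (x≡b , y≡a) = ∧-true⁻ {x ≡ᵇ b} xy≡ba in inj₂ (≡ᵇ-true⇒≡ x≡b , ≡ᵇ-true⇒≡ y≡a)
  ... | false | false = ⊥-elim (≡true⇒≢false e (trans (sym (∧-identityʳ (E G x y))) e′))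

  E′-ab : E G′ a b ≡ false
  E′-ab = ≢true⇒≡false λ e → ≡true⇒≢false
    (cong₂ (λ z w → (z ∧ w) ∨ ((a ≡ᵇ b) ∧ (b ≡ᵇ a))) (≡ᵇ-refl a) (≡ᵇ-refl b))
    (not-true⁻ (proj₂ (∧-true⁻ {E G a b} e)))

  ends-disconnected : ∀ {p q} → End p → End q → p ≢ q → E G′ p q ≡ false
  ends-disconnected (inj₁ refl) (inj₁ refl) p≢q = ⊥-elim (p≢q refl)
  ends-disconnected (inj₁ refl) (inj₂ refl) _ = E′-ab
  ends-disconnected (inj₂ refl) (inj₁ refl) _ = E′-sym E′-ab
  ends-disconnected (inj₂ refl) (inj₂ refl) p≢q = ⊥-elim (p≢q refl)

  loses⇒end : ∀ x → V G x ≡ true → loses x ≡ true → End x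
  loses⇒end x x∈G l with y , e , e′ ← loses⁻ x x∈G l =
    [ (λ (x≡a , _) → inj₁ x≡a) , (λ (x≡b , _) → inj₂ x≡b) ] (lost-edge⇒ends e e′)

  end-of-lost-edge : ∀ {p q} → E G p q ≡ true → E G′ p q ≡ false → ∀ {w} → End w → w ≡ p ⊎ w ≡ q
  end-of-lost-edge epq epq′ w-end with lost-edge⇒ends epq epq′ | w-end
  ... | inj₁ (refl , refl) | inj₁ refl = inj₁ refl
  ... | inj₁ (refl , refl) | inj₂ refl = inj₂ refl
  ... | inj₂ (refl , refl) | inj₁ refl = inj₂ refl
  ... | inj₂ (refl , refl) | inj₂ refl = inj₁ refl

  common-nbr-keeps : ∀ u p q → E G′ u p ≡ true → E G′ u q ≡ true → E G p q ≡ true → E G′ p q ≡ false →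
                     loses u ≡ false
  common-nbr-keeps u p q eup euq epq epq′ = ≢true⇒≡false λ l →
    [ (λ u≡p → ≡true⇒≢false euq (trans (cong (λ z → E G′ z q) u≡p) epq′))
    , (λ u≡q → ≡true⇒≢false eup (trans (cong (λ z → E G′ z p) u≡q) (E′-sym epq′))) ]
    (end-of-lost-edge epq epq′ (loses⇒end u (WF.endpoints wf u p (E-shrink eup)) l))

  older-end-reports : ∀ u p q → E G′ u p ≡ true → E G′ u q ≡ true → E G p q ≡ true → E G′ p q ≡ false →
                      (losesNbrAdjTo p u ∨ losesNbrAdjTo q u) ≡ true
  older-end-reports u p q eup euq epq epq′ with rank p <? rank q
  ... | yes p<q = ∨-trueˡ _ (losesNbrAdjTo⁺ p q u p∈G epq epq′
        (Accurate.known-complete (prevState-accurate p p∈G) q u epq epu equ (λ (q<p , _) → <-asym p<q q<p)))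
    where
    p∈G = endpointʳ wf u p (E-shrink eup)
    epu = E-sym wf (E-shrink eup)
    equ = E-sym wf (E-shrink euq)
  ... | no p≮q = ∨-trueʳ (losesNbrAdjTo p u) (losesNbrAdjTo⁺ q p u q∈G (E-sym wf epq) (E′-sym epq′)
        (Accurate.known-complete (prevState-accurate q q∈G) p u (E-sym wf epq) equ epu (λ (p<q , _) → p≮q p<q)))
    where
    q∈G = endpointʳ wf u q (E-shrink euq)
    epu = E-sym wf (E-shrink eup)
    equ = E-sym wf (E-shrink euq)

  deletions-noticed : DeletionsNoticed
  deletions-noticed u p q eup euq epq not-deleted = ≢false⇒≡true λ epq′ → ≡true⇒≢false
    (deletedAt⁺ u p q eup euq (common-nbr-keeps u p q eup euq epq epq′)
      (loses⁺ p q (endpointʳ wf u p (E-shrink eup)) epq epq′)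
      (loses⁺ q p (endpointʳ wf u q (E-shrink euq)) (E-sym wf epq) (E′-sym epq′))
      (older-end-reports u p q eup euq epq epq′))
    not-deleted

  survivors-kept : SurvivorsKept
  survivors-kept u p q eup euq epq = ≢true⇒≡false λ e →
    let (_ , p-loses , q-loses , _) = deletedAt⁻ u p q eup euq e
    in ≡true⇒≢false epq (ends-disconnected
         (loses⇒end p (endpointʳ wf u p (E-shrink eup)) p-loses)
         (loses⇒end q (endpointʳ wf u q (E-shrink euq)) q-loses) (E⇒≢ wf′ epq))

  invariant : Invariant s G′ σ′
  invariant = shrinking-invariant deletions-noticed survivors-kept

round-invariant : ∀ {s G σ} → Invariant s G σ → ∀ ch → ValidChange G ch →
                  Invariant s (apply G ch) (round (cliqueLister s) (apply G ch) σ)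
round-invariant I noChange _ = NoChange.invariant I
round-invariant I (insNode v N) vc = InsNode.invariant I v N vc
round-invariant I (delNode v) vc = DelNode.invariant I v vc
round-invariant I (delEdge a b) vc = DelEdge.invariant I a b vc

initial-invariant : ∀ s G → WF G → Invariant s G (initConfig (cliqueLister s) G)
initial-invariant s G wf = record
  { wf = wf ; rank = λ _ → 0 ; rankBound = 1 ; rank<bound = λ _ _ → s≤s z≤n
  ; absent = absent ; present = present }
  where
  absent : ∀ w → V G w ≡ false → initConfig (cliqueLister s) G w ≡ nothing
  absent w w∉G rewrite w∉G = refl
  present : ∀ w → V G w ≡ true →
            Σ NodeState λ st → initConfig (cliqueLister s) G w ≡ just st × Accurate G (λ _ → 0) w st
  present w w∈G rewrite w∈G = _ , refl , record
    { self≡ = refl ; lastNbrs≡ = refl ; known-sound = λ _ _ e → e ; known-complete = λ _ _ _ _ e _ → e }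

invariant⇒good : ∀ {s G σ} c → 1 ≤ s → Invariant s G σ → ∀ chs → Good (cliqueLister s) s c G σ chs
invariant⇒good c 1≤s I [] = tt
invariant⇒good c 1≤s I (ch ∷ chs) vc _ = Listing.correct I′ 1≤s , invariant⇒good c 1≤s I′ chs
  where
  I′ = round-invariant I ch vc

-- Messages never carry IDs.
theorem1 : ∀ (s c : ℕ) → 1 ≤ s →
    ∃[ B ] Σ (Alg B) (λ A →
    ∀ (G₀ : Graph) → WF G₀ → IDsOK c G₀ → ∀ (chs : List Change) →
    Good A s c G₀ (initConfig A G₀) chs)
theorem1 s c 1≤s = 3 , cliqueLister s , λ G₀ wf _ → invariant⇒good c 1≤s (initial-invariant s G₀ wf)
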